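{- Let $M$ be a $3$-connected matroid with $|E(M)|\ge 4$. If $G$ is a connected weak framework for $M$, then $G$ is $2$-connected.
   Context: For a graph $G$ and a vertex $v$, $\mathrm{loops}_G(v)$ denotes the set of loop-edges of $G$ at $v$. Graphs are finite and may have loops and parallel edges. A graph $G$ is a weak framework for a matroid $M$ if (1) $E(G)=E(M)$; (2) $r_M(E(H))\le |V(H)|$ for each component $H$ of $G$; and (3) for each vertex $v$ of $G$, $\mathrm{cl}_M(E(G-v))\subseteq E(G-v)\cup \mathrm{loops}_G(v)$. Convention: a graph $G$ is $k$-connected when $G-X$ is connected for each set $X\subseteq V(G)$ with $|X|<k$ (it is not required that $|V(G)|>k$), and the graph with no vertices is considered connected. -}

module Defs where

open import Data.Nat using (ℕ; _+_; _≤_; _<_; suc)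
open import Data.Bool using (Bool; true; false; _∧_)
open import Data.Fin using (Fin)
open import Data.Fin.Subset using (Subset; _∈_; _∉_; _⊆_; _∪_; _∩_; ∁; ⁅_⁆; ⊤; ∣_∣)
open import Data.Vec using (tabulate; lookup)
open import Data.Product using (Σ; ∃; _×_; _,_; proj₁; proj₂)
open import Data.Sum using (_⊎_)
open import Relation.Binary.PropositionalEquality using (_≡_)
open import Relation.Binary.Construct.Closure.ReflexiveTransitive using (Star)
open import Relation.Nullary using (¬_)

record Matroid (m : ℕ) : Set where
  field
    r        : Subset m → ℕ
    r-bound  : ∀ X → r X ≤ ∣ X ∣
    r-mono   : ∀ {X Y} → X ⊆ Y → r X ≤ r Y
    r-submod : ∀ X Y → r (X ∪ Y) + r (X ∩ Y) ≤ r X + r Y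

open Matroid public

InClosure : ∀ {m} → Matroid m → Subset m → Fin m → Set
InClosure M X e = r M (X ∪ ⁅ e ⁆) ≡ r M X

-- (A, E − A) is an l-separation:  |A| ≥ l, |E − A| ≥ l,
-- r(A) + r(E − A) − r(M) ≤ l − 1   (i.e. r(A) + r(E − A) < r(M) + l)
IsSeparation : ∀ {m} → Matroid m → ℕ → Subset m → Set
IsSeparation M l A =
  (l ≤ ∣ A ∣) × (l ≤ ∣ ∁ A ∣) × (r M A + r M (∁ A) < r M ⊤ + l)

MatroidConnected : ∀ {m} → ℕ → Matroid m → Set
MatroidConnected k M = ∀ l A → 1 ≤ l → l < k → ¬ IsSeparation M l A

-- Graphs with vertex set Fin n and edge set Fin m; loops and parallel
-- edges allowed.  An edge e has ends (proj₁ (ends e), proj₂ (ends e));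
-- it is a loop when the two ends coincide.

record Graph (n m : ℕ) : Set where
  field
    ends : Fin m → Fin n × Fin n

open Graph public

edgesIn : ∀ {n m} → Graph n m → Subset n → Subset m
edgesIn G S = tabulate λ e → lookup S (proj₁ (ends G e)) ∧ lookup S (proj₂ (ends G e))

Adj : ∀ {n m} → Graph n m → Subset n → Fin n → Fin n → Set
Adj G S x y = Σ (Fin _) λ e → e ∈ edgesIn G S ×
  ((ends G e ≡ (x , y)) ⊎ (ends G e ≡ (y , x)))

ConnectedOn : ∀ {n m} → Graph n m → Subset n → Set
ConnectedOn G S = ∀ u v → u ∈ S → v ∈ S → Star (Adj G S) u v

Connected : ∀ {n m} → Graph n m → Set
Connected G = ConnectedOn G ⊤

KConnected : ∀ {n m} → ℕ → Graph n m → Set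
KConnected k G = ∀ X → ∣ X ∣ < k → ConnectedOn G (∁ X)

IsComponent : ∀ {n m} → Graph n m → Subset n → Set
IsComponent G C =
  (∃ λ u → u ∈ C) × ConnectedOn G C ×
  (∀ e → (proj₁ (ends G e) ∈ C → proj₂ (ends G e) ∈ C) ×
         (proj₂ (ends G e) ∈ C → proj₁ (ends G e) ∈ C))

loopsAt : ∀ {n m} → Graph n m → Fin n → Subset m
loopsAt G v = edgesIn G ⁅ v ⁆

-- G is a weak framework for M  (condition (1), E(G) = E(M), is built in:
-- both have edge/ground set Fin m)
IsWeakFramework : ∀ {n m} → Graph n m → Matroid m → Set
IsWeakFramework G M =
  (∀ C → IsComponent G C → r M (edgesIn G C) ≤ ∣ C ∣) ×
  (∀ v e → InClosure M (edgesIn G (∁ ⁅ v ⁆)) e →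
           e ∈ (edgesIn G (∁ ⁅ v ⁆) ∪ loopsAt G v))

module Submission where

-- An edge joining y to a vertex x ≠ y is neither in E(G − y) nor a loop at y,
-- so by the framework axiom it lies outside cl(E(G − y)); hence adding to a
-- vertex set W ∌ y a vertex y adjacent to W raises the rank of the induced
-- edge set. Growing W one vertex at a time through the connected graph G
-- gives r(E(G[W])) + |V − W| ≤ r(M). Suppose a set X of at most one vertex
-- separates u from w, let R be the vertices reachable from u in G − X and put
-- A = E(G[R ∪ X]). Every edge outside A lies in G[V − R], so the growth bound
-- applied to R ∪ X and to V − R, together with r(M) ≤ |V|, forces
-- r(A) + r(E − A) ≤ r(M) + 1 with both sides of (A, E − A) large: a 1- or
-- 2-separation of M.

open import Defs
open import Data.Bool using (true; false; _∧_)
open import Data.Bool.Properties using (∧-conicalˡ; ∧-conicalʳ)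
open import Data.Fin using (Fin) renaming (_≟_ to _≟ᶠ_)
open import Data.Fin.Properties using (any?)
open import Data.Fin.Subset
  using (Subset; _∈_; _∉_; _⊆_; _∪_; _∩_; ∁; ⁅_⁆; ⊤; ⊥; ∣_∣)
open import Data.Fin.Subset.Properties
open import Data.Nat using (suc; _+_; _≤_; _<_; s≤s; z≤n)
open import Data.Nat.Properties
open import Data.Nat.Tactic.RingSolver using (solve-∀)
open import Data.Product using (∃; ∃₂; _×_; _,_; proj₁; proj₂)
open import Data.Product.Properties using (≡-dec)
open import Data.Sum using (_⊎_; inj₁; inj₂; [_,_]′)
open import Data.Vec using (_∷_; [])
open import Data.Vec.Properties using (lookup∘tabulate; []=⇒lookup; lookup⇒[]=)
open import Relation.Binary.Construct.Closure.ReflexiveTransitive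
  using (Star; ε; _◅_; _◅◅_)
open import Relation.Binary.PropositionalEquality
open import Relation.Nullary using (¬_; Dec; yes; no; contradiction)
open import Relation.Nullary.Decidable using (_×-dec_; _⊎-dec_; ¬?; decidable-stable)

∣p∪q∣≤∣p∣+∣q∣ : ∀ {n} (p q : Subset n) → ∣ p ∪ q ∣ ≤ ∣ p ∣ + ∣ q ∣
∣p∪q∣≤∣p∣+∣q∣ []          []          = z≤n
∣p∪q∣≤∣p∣+∣q∣ (true ∷ p)  (true ∷ q)  = s≤s (≤-trans (∣p∪q∣≤∣p∣+∣q∣ p q) (+-monoʳ-≤ ∣ p ∣ (n≤1+n _)))
∣p∪q∣≤∣p∣+∣q∣ (true ∷ p)  (false ∷ q) = s≤s (∣p∪q∣≤∣p∣+∣q∣ p q)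
∣p∪q∣≤∣p∣+∣q∣ (false ∷ p) (true ∷ q)  = ≤-trans (s≤s (∣p∪q∣≤∣p∣+∣q∣ p q)) (≤-reflexive (sym (+-suc _ _)))
∣p∪q∣≤∣p∣+∣q∣ (false ∷ p) (false ∷ q) = ∣p∪q∣≤∣p∣+∣q∣ p q

∣p∣+∣∁p∣≡n : ∀ {n} (p : Subset n) → ∣ p ∣ + ∣ ∁ p ∣ ≡ n
∣p∣+∣∁p∣≡n p = trans (cong (∣ p ∣ +_) (∣∁p∣≡n∸∣p∣ p)) (m+[n∸m]≡n (∣p∣≤n p))

x∈p⇒0<∣p∣ : ∀ {n} {x : Fin n} {p : Subset n} → x ∈ p → 0 < ∣ p ∣
x∈p⇒0<∣p∣ {x = x} {p} x∈p = ≤-trans (≤-reflexive (sym (∣⁅x⁆∣≡1 x)))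
  (p⊆q⇒∣p∣≤∣q∣ λ y∈⁅x⁆ → subst (_∈ p) (sym (x∈⁅y⁆⇒x≡y x y∈⁅x⁆)) x∈p)

∣∁p∣≤1+∣∁[p∪⁅x⁆]∣ : ∀ {n} (p : Subset n) x → ∣ ∁ p ∣ ≤ suc ∣ ∁ (p ∪ ⁅ x ⁆) ∣
∣∁p∣≤1+∣∁[p∪⁅x⁆]∣ p x = begin
  ∣ ∁ p ∣                        ≤⟨ p⊆q⇒∣p∣≤∣q∣ ∁p⊆ ⟩
  ∣ ⁅ x ⁆ ∪ ∁ (p ∪ ⁅ x ⁆) ∣      ≤⟨ ∣p∪q∣≤∣p∣+∣q∣ ⁅ x ⁆ _ ⟩
  ∣ ⁅ x ⁆ ∣ + ∣ ∁ (p ∪ ⁅ x ⁆) ∣  ≡⟨ cong (_+ ∣ ∁ (p ∪ ⁅ x ⁆) ∣) (∣⁅x⁆∣≡1 x) ⟩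
  suc ∣ ∁ (p ∪ ⁅ x ⁆) ∣          ∎
  where
  open ≤-Reasoning
  ∁p⊆ : ∁ p ⊆ ⁅ x ⁆ ∪ ∁ (p ∪ ⁅ x ⁆)
  ∁p⊆ {y} y∈∁p with y ≟ᶠ x
  ... | yes refl = x∈p∪q⁺ (inj₁ (x∈⁅x⁆ x))
  ... | no y≢x   = x∈p∪q⁺ (inj₂ (x∉p⇒x∈∁p λ y∈p∪x →
    [ x∈∁p⇒x∉p y∈∁p , x≢y⇒x∉⁅y⁆ y≢x ]′ (x∈p∪q⁻ p _ y∈p∪x)))

∣∁[p∪⁅x⁆]∣<∣∁p∣ : ∀ {n} {p : Subset n} {x} → x ∉ p → ∣ ∁ (p ∪ ⁅ x ⁆) ∣ < ∣ ∁ p ∣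
∣∁[p∪⁅x⁆]∣<∣∁p∣ {p = p} {x} x∉p =
  p⊂q⇒∣p∣<∣q∣ (p⊂q⇒∁p⊃∁q (p⊆p∪q _ , x , x∈p∪q⁺ (inj₂ (x∈⁅x⁆ x)) , x∉p))

∪⁅⁆-⊆ : ∀ {n} {p q : Subset n} {x} → p ⊆ q → x ∈ q → p ∪ ⁅ x ⁆ ⊆ q
∪⁅⁆-⊆ {p = p} {x = x} p⊆q x∈q y∈p∪x with x∈p∪q⁻ p ⁅ x ⁆ y∈p∪x
... | inj₁ y∈p = p⊆q y∈p
... | inj₂ y∈x = subst (_∈ _) (sym (x∈⁅y⁆⇒x≡y x y∈x)) x∈q

module _ {m} (M : Matroid m) where

  ¬closure⇒rank-step : ∀ {Y Z e} → Y ⊆ Z → ¬ InClosure M Z e → suc (r M Y) ≤ r M (Y ∪ ⁅ e ⁆)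
  ¬closure⇒rank-step {Y} {Z} {e} Y⊆Z e∉clZ = +-cancelˡ-≤ (r M Z) _ _ (begin
    r M Z + suc (r M Y)                           ≡⟨ +-suc _ _ ⟩
    suc (r M Z) + r M Y                           ≤⟨ +-mono-≤ rZ<rZe (r-mono M Y⊆) ⟩
    r M (Z ∪ ⁅ e ⁆) + r M (Ye ∩ Z)                ≤⟨ +-monoˡ-≤ _ (r-mono M Ze⊆) ⟩
    r M (Ye ∪ Z) + r M (Ye ∩ Z)                   ≤⟨ r-submod M Ye Z ⟩
    r M Ye + r M Z                                ≡⟨ +-comm (r M Ye) (r M Z) ⟩
    r M Z + r M Ye                                ∎)
    where
    open ≤-Reasoning
    Ye = Y ∪ ⁅ e ⁆
    rZ<rZe : r M Z < r M (Z ∪ ⁅ e ⁆)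
    rZ<rZe = ≤∧≢⇒< (r-mono M (p⊆p∪q _)) (λ eq → e∉clZ (sym eq))
    Ze⊆ : Z ∪ ⁅ e ⁆ ⊆ Ye ∪ Z
    Ze⊆ = ∪⁅⁆-⊆ (q⊆p∪q Ye Z) (p⊆p∪q Z (q⊆p∪q Y _ (x∈⁅x⁆ e)))
    Y⊆ : Y ⊆ Ye ∩ Z
    Y⊆ y∈Y = x∈p∩q⁺ (p⊆p∪q _ y∈Y , Y⊆Z y∈Y)

  r[⊤]≤r[A]+r[∁A] : ∀ A → r M ⊤ ≤ r M A + r M (∁ A)
  r[⊤]≤r[A]+r[∁A] A = begin
    r M ⊤                                  ≡⟨ cong (r M) (sym (p∪∁p≡⊤ A)) ⟩
    r M (A ∪ ∁ A)                          ≤⟨ m≤m+n _ _ ⟩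
    r M (A ∪ ∁ A) + r M (A ∩ ∁ A)          ≤⟨ r-submod M A (∁ A) ⟩
    r M A + r M (∁ A)                      ∎
    where open ≤-Reasoning

module _ {m} (M : Matroid m) (3-conn : MatroidConnected 3 M) where

  3-connected⇒no-separation : ∀ l A → 1 ≤ l → l < 3 → l ≤ ∣ A ∣ → l ≤ ∣ ∁ A ∣ →
                              r M ⊤ + l ≤ r M A + r M (∁ A)
  3-connected⇒no-separation l A 1≤l l<3 l≤∣A∣ l≤∣∁A∣ =
    ≮⇒≥ λ lt → 3-conn l A 1≤l l<3 (l≤∣A∣ , l≤∣∁A∣ , lt)

  -- p and q will be the numbers of vertices on the two sides of a vertex cut
  -- of size at most one.
  3-connected⇒rank-large : ∀ A {p q} → 0 < p → 0 < q →
                           r M A + q ≤ r M ⊤ → r M (∁ A) + p ≤ r M ⊤ →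
                           p + 1 + q < r M ⊤
  3-connected⇒rank-large A {p} {q} 0<p 0<q a+q≤T b+p≤T = +-cancelˡ-≤ T _ _ (begin
    T + suc (p + 1 + q)        ≡⟨ regroupˡ T p q ⟩
    T + 2 + (p + q)            ≤⟨ +-monoˡ-≤ (p + q) T+2≤a+b ⟩
    a + b + (p + q)            ≡⟨ regroupʳ a b p q ⟩
    a + q + (b + p)            ≤⟨ +-mono-≤ a+q≤T b+p≤T ⟩
    T + T                      ∎)
    where
    open ≤-Reasoning
    T = r M ⊤
    a = r M A
    b = r M (∁ A)
    regroupˡ : ∀ T p q → T + suc (p + 1 + q) ≡ T + 2 + (p + q)
    regroupˡ = solve-∀
    regroupʳ : ∀ a b p q → a + b + (p + q) ≡ a + q + (b + p)
    regroupʳ = solve-∀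
    T≤a+b = r[⊤]≤r[A]+r[∁A] M A
    p≤a : p ≤ a
    p≤a = +-cancelˡ-≤ b _ _ (≤-trans b+p≤T (≤-trans T≤a+b (≤-reflexive (+-comm a b))))
    q≤b : q ≤ b
    q≤b = +-cancelˡ-≤ a _ _ (≤-trans a+q≤T T≤a+b)
    T<a+b : T < a + b
    T<a+b = ≤-trans (≤-reflexive (+-comm 1 T)) (3-connected⇒no-separation 1 A ≤-refl (s≤s (s≤s z≤n))
      (≤-trans 0<p (≤-trans p≤a (r-bound M A))) (≤-trans 0<q (≤-trans q≤b (r-bound M (∁ A)))))
    -- A side with at most one element has rank at most 1 ≤ p (resp. q), which
    -- would push r(A) + r(E − A) down to r(M).
    2≤∣A∣ : 2 ≤ ∣ A ∣
    2≤∣A∣ = ≰⇒> λ ∣A∣≤1 → <⇒≱ T<a+b (begin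
      a + b   ≤⟨ +-monoˡ-≤ b (≤-trans (r-bound M A) (≤-trans ∣A∣≤1 0<p)) ⟩
      p + b   ≡⟨ +-comm p b ⟩
      b + p   ≤⟨ b+p≤T ⟩
      T       ∎)
    2≤∣∁A∣ : 2 ≤ ∣ ∁ A ∣
    2≤∣∁A∣ = ≰⇒> λ ∣∁A∣≤1 → <⇒≱ T<a+b (begin
      a + b   ≤⟨ +-monoʳ-≤ a (≤-trans (r-bound M (∁ A)) (≤-trans ∣∁A∣≤1 0<q)) ⟩
      a + q   ≤⟨ a+q≤T ⟩
      T       ∎)
    T+2≤a+b : T + 2 ≤ a + b
    T+2≤a+b = 3-connected⇒no-separation 2 A (s≤s z≤n) ≤-refl 2≤∣A∣ 2≤∣∁A∣

module _ {n m} (G : Graph n m) where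

  Link : Fin m → Fin n → Fin n → Set
  Link e x y = ends G e ≡ (x , y) ⊎ ends G e ≡ (y , x)

  ∈edgesIn⁺ : ∀ {W e} → proj₁ (ends G e) ∈ W → proj₂ (ends G e) ∈ W → e ∈ edgesIn G W
  ∈edgesIn⁺ {W} {e} x∈W y∈W = lookup⇒[]= e (edgesIn G W)
    (trans (lookup∘tabulate _ e) (cong₂ _∧_ ([]=⇒lookup x∈W) ([]=⇒lookup y∈W)))

  ∈edgesIn⁻ : ∀ {W e} → e ∈ edgesIn G W → proj₁ (ends G e) ∈ W × proj₂ (ends G e) ∈ W
  ∈edgesIn⁻ {W} {e} e∈ = lookup⇒[]= _ W (∧-conicalˡ _ _ both) , lookup⇒[]= _ W (∧-conicalʳ _ _ both)
    where both = trans (sym (lookup∘tabulate _ e)) ([]=⇒lookup e∈)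

  link-∈edgesIn⁺ : ∀ {W e x y} → Link e x y → x ∈ W → y ∈ W → e ∈ edgesIn G W
  link-∈edgesIn⁺ {W} (inj₁ eq) x∈W y∈W =
    ∈edgesIn⁺ (subst (λ p → proj₁ p ∈ W) (sym eq) x∈W) (subst (λ p → proj₂ p ∈ W) (sym eq) y∈W)
  link-∈edgesIn⁺ {W} (inj₂ eq) x∈W y∈W =
    ∈edgesIn⁺ (subst (λ p → proj₁ p ∈ W) (sym eq) y∈W) (subst (λ p → proj₂ p ∈ W) (sym eq) x∈W)

  link-∈edgesIn⁻ : ∀ {W e x y} → Link e x y → e ∈ edgesIn G W → x ∈ W × y ∈ W
  link-∈edgesIn⁻ {W} (inj₁ eq) e∈ with ∈edgesIn⁻ e∈
  ... | a , b = subst (λ p → proj₁ p ∈ W) eq a , subst (λ p → proj₂ p ∈ W) eq b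
  link-∈edgesIn⁻ {W} (inj₂ eq) e∈ with ∈edgesIn⁻ e∈
  ... | a , b = subst (λ p → proj₂ p ∈ W) eq b , subst (λ p → proj₁ p ∈ W) eq a

  edgesIn-mono : ∀ {W W′} → W ⊆ W′ → edgesIn G W ⊆ edgesIn G W′
  edgesIn-mono W⊆W′ e∈ with ∈edgesIn⁻ e∈
  ... | x∈W , y∈W = ∈edgesIn⁺ (W⊆W′ x∈W) (W⊆W′ y∈W)

  module _ (S : Subset n) where

    Closed : Subset n → Set
    Closed R = ∀ {x y} → x ∈ R → Adj G S x y → y ∈ R

    closed-star : ∀ {R x y} → Closed R → x ∈ R → Star (Adj G S) x y → y ∈ R
    closed-star R-closed x∈R ε             = x∈R
    closed-star R-closed x∈R (x~z ◅ z⇝y) = closed-star R-closed (R-closed x∈R x~z) z⇝y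

    closed-self : Closed S
    closed-self _ (_ , e∈ , link) = proj₂ (link-∈edgesIn⁻ link e∈)

    adj? : ∀ x y → Dec (Adj G S x y)
    adj? x y = any? λ e → (e ∈? edgesIn G S) ×-dec ((ends G e ≟² (x , y)) ⊎-dec (ends G e ≟² (y , x)))
      where _≟²_ = ≡-dec _≟ᶠ_ _≟ᶠ_

    exit? : ∀ R → Dec (∃₂ λ x y → x ∈ R × y ∉ R × Adj G S x y)
    exit? R = any? λ x → any? λ y → (x ∈? R) ×-dec ¬? (y ∈? R) ×-dec adj? x y

    exit-induction : (P : Subset n → Set) →
                     (∀ {R} → Closed R → P R) →
                     (∀ {R x y} → x ∈ R → y ∉ R → Adj G S x y → P (R ∪ ⁅ y ⁆) → P R) →
                     ∀ R → P R
    exit-induction P closed extend R = go (suc ∣ ∁ R ∣) R ≤-refl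
      where
      go : ∀ k R → ∣ ∁ R ∣ < k → P R
      go (suc k) R ∣∁R∣<1+k with exit? R
      ... | yes (x , y , x∈R , y∉R , x~y) =
        extend x∈R y∉R x~y (go k _ (<-≤-trans (∣∁[p∪⁅x⁆]∣<∣∁p∣ y∉R) (≤-pred ∣∁R∣<1+k)))
      ... | no ¬exit = closed λ {x} {y} x∈R x~y →
        decidable-stable (y ∈? R) λ y∉R → ¬exit (x , y , x∈R , y∉R , x~y)

    Reachable : Fin n → Subset n → Set
    Reachable u R = ∀ {z} → z ∈ R → Star (Adj G S) u z

    reachable⇒⊆closed : ∀ {u} R → Reachable u R → ∃ λ R′ → R ⊆ R′ × Closed R′ × Reachable u R′
    reachable⇒⊆closed {u} = exit-induction P (λ R-closed reach → _ , (λ z∈R → z∈R) , R-closed , reach) extend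
      where
      P : Subset n → Set
      P R = Reachable u R → ∃ λ R′ → R ⊆ R′ × Closed R′ × Reachable u R′
      extend : ∀ {R x y} → x ∈ R → y ∉ R → Adj G S x y → P (R ∪ ⁅ y ⁆) → P R
      extend {R} {x} {y} x∈R _ x~y ih reach =
        let R′ , R∪y⊆R′ , R′-closed , reach-R′ = ih reach-R∪y
        in  R′ , (λ z∈R → R∪y⊆R′ (p⊆p∪q _ z∈R)) , R′-closed , reach-R′
        where
        reach-R∪y : Reachable u (R ∪ ⁅ y ⁆)
        reach-R∪y z∈ with x∈p∪q⁻ R ⁅ y ⁆ z∈
        ... | inj₁ z∈R = reach z∈R
        ... | inj₂ z∈y = subst (Star _ u) (sym (x∈⁅y⁆⇒x≡y y z∈y)) (reach x∈R ◅◅ (x~y ◅ ε))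

    reachable-closure : ∀ u → ∃ λ R → u ∈ R × Closed R × Reachable u R
    reachable-closure u =
      let R , ⁅u⁆⊆R , R-closed , reach = reachable⇒⊆closed ⁅ u ⁆ reach-⁅u⁆
      in  R , ⁅u⁆⊆R (x∈⁅x⁆ u) , R-closed , reach
      where
      reach-⁅u⁆ : Reachable u ⁅ u ⁆
      reach-⁅u⁆ z∈ = subst (Star _ u) (sym (x∈⁅y⁆⇒x≡y u z∈)) ε

  -- No edge of G[V − X] leaves R, so an edge with an end in R lies in G[R ∪ X].
  closed⇒∁edgesIn⊆ : ∀ {X R} → Closed (∁ X) R → R ⊆ ∁ X → ∁ (edgesIn G (R ∪ X)) ⊆ edgesIn G (∁ R)
  closed⇒∁edgesIn⊆ {X} {R} R-closed R⊆∁X {e} e∉A =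
    ∈edgesIn⁺ (end∉R (inj₁ refl)) (end∉R (inj₂ refl))
    where
    end∈R⇒∈A : ∀ {x y} → Link e x y → x ∈ R → e ∈ edgesIn G (R ∪ X)
    end∈R⇒∈A {y = y} link x∈R with y ∈? X
    ... | yes y∈X = link-∈edgesIn⁺ link (x∈p∪q⁺ (inj₁ x∈R)) (x∈p∪q⁺ (inj₂ y∈X))
    ... | no y∉X  = link-∈edgesIn⁺ link (x∈p∪q⁺ (inj₁ x∈R)) (x∈p∪q⁺ (inj₁ (R-closed x∈R
                      (e , link-∈edgesIn⁺ link (R⊆∁X x∈R) (x∉p⇒x∈∁p y∉X) , link))))
    end∉R : ∀ {x y} → Link e x y → x ∈ ∁ R
    end∉R link = x∉p⇒x∈∁p λ x∈R → x∈∁p⇒x∉p e∉A (end∈R⇒∈A link x∈R)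

module _ {n m} (M : Matroid m) (G : Graph n m) (wf : IsWeakFramework G M) where

  link-∉closure : ∀ {e x y} → Link G e x y → x ≢ y → ¬ InClosure M (edgesIn G (∁ ⁅ y ⁆)) e
  link-∉closure {e} {x} {y} link x≢y e∈cl with x∈p∪q⁻ _ _ (proj₂ wf y e e∈cl)
  ... | inj₁ e∈E[G-y] = x∈∁p⇒x∉p (proj₂ (link-∈edgesIn⁻ G link e∈E[G-y])) (x∈⁅x⁆ y)
  ... | inj₂ e∈loops  = x≢y (x∈⁅y⁆⇒x≡y y (proj₁ (link-∈edgesIn⁻ G link e∈loops)))

  link-rank-step : ∀ {W e x y} → Link G e x y → x ∈ W → y ∉ W →
                   suc (r M (edgesIn G W)) ≤ r M (edgesIn G (W ∪ ⁅ y ⁆))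
  link-rank-step {W} {e} {x} {y} link x∈W y∉W =
    ≤-trans (¬closure⇒rank-step M (edgesIn-mono G W⊆V-y) (link-∉closure link x≢y))
            (r-mono M (∪⁅⁆-⊆ (edgesIn-mono G (p⊆p∪q {p = W} ⁅ y ⁆)) (link-∈edgesIn⁺ G link (p⊆p∪q _ x∈W) y∈W∪y)))
    where
    x≢y : x ≢ y
    x≢y refl = y∉W x∈W
    W⊆V-y : W ⊆ ∁ ⁅ y ⁆
    W⊆V-y z∈W = x∉p⇒x∈∁p λ z∈y → y∉W (subst (_∈ W) (x∈⁅y⁆⇒x≡y y z∈y) z∈W)
    y∈W∪y : y ∈ W ∪ ⁅ y ⁆
    y∈W∪y = x∈p∪q⁺ (inj₂ (x∈⁅x⁆ y))

  connected⇒r[edgesIn-W]+∣∁W∣≤r[⊤] : Connected G → ∀ {a W} → a ∈ W →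
                            r M (edgesIn G W) + ∣ ∁ W ∣ ≤ r M ⊤
  connected⇒r[edgesIn-W]+∣∁W∣≤r[⊤] conn {a} {W} = exit-induction G ⊤ P closed extend W
    where
    open ≤-Reasoning
    P : Subset n → Set
    P W = a ∈ W → r M (edgesIn G W) + ∣ ∁ W ∣ ≤ r M ⊤
    closed : ∀ {W} → Closed G ⊤ W → P W
    closed {W} W-closed a∈W = begin
      r M (edgesIn G W) + ∣ ∁ W ∣  ≤⟨ +-monoʳ-≤ _ (p⊆q⇒∣p∣≤∣q∣ ∁W⊆⊥) ⟩
      r M (edgesIn G W) + ∣ ⊥ {n} ∣ ≡⟨ cong (r M (edgesIn G W) +_) (∣⊥∣≡0 n) ⟩
      r M (edgesIn G W) + 0        ≡⟨ +-identityʳ _ ⟩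
      r M (edgesIn G W)            ≤⟨ r-mono M ⊆⊤ ⟩
      r M ⊤                        ∎
      where
      ∁W⊆⊥ : ∁ W ⊆ ⊥
      ∁W⊆⊥ {z} z∈∁W = contradiction (closed-star G ⊤ W-closed a∈W (conn a z ∈⊤ ∈⊤)) (x∈∁p⇒x∉p z∈∁W)
    extend : ∀ {W x y} → x ∈ W → y ∉ W → Adj G ⊤ x y → P (W ∪ ⁅ y ⁆) → P W
    extend {W} {x} {y} x∈W y∉W (_ , _ , link) ih a∈W = begin
      r M (edgesIn G W) + ∣ ∁ W ∣              ≤⟨ +-monoʳ-≤ _ (∣∁p∣≤1+∣∁[p∪⁅x⁆]∣ W y) ⟩
      r M (edgesIn G W) + suc ∣ ∁ W′ ∣         ≡⟨ +-suc _ _ ⟩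
      suc (r M (edgesIn G W)) + ∣ ∁ W′ ∣       ≤⟨ +-monoˡ-≤ _ (link-rank-step link x∈W y∉W) ⟩
      r M (edgesIn G W′) + ∣ ∁ W′ ∣            ≤⟨ ih (p⊆p∪q _ a∈W) ⟩
      r M ⊤                                    ∎
      where W′ = W ∪ ⁅ y ⁆

  connected⇒r[⊤]≤n : Connected G → Fin n → r M ⊤ ≤ n
  connected⇒r[⊤]≤n conn u = begin
    r M ⊤                  ≤⟨ r-mono M (λ _ → ∈edgesIn⁺ G ∈⊤ ∈⊤) ⟩
    r M (edgesIn G ⊤)      ≤⟨ proj₁ wf ⊤ ((u , ∈⊤) , conn , λ _ → (λ _ → ∈⊤) , (λ _ → ∈⊤)) ⟩
    ∣ ⊤ {n} ∣              ≡⟨ ∣⊤∣≡n n ⟩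
    n                      ∎
    where open ≤-Reasoning

lemma3p8 : ∀ {n m} (M : Matroid m) (G : Graph n m) →
    MatroidConnected 3 M → 4 ≤ m →
    Connected G → IsWeakFramework G M → KConnected 2 G
lemma3p8 {n} M G 3-conn _ conn wf X ∣X∣<2 u w u∈∁X w∈∁X
  with reachable-closure G (∁ X) u
... | R , u∈R , R-closed , reach with w ∈? R
...   | yes w∈R = reach w∈R
...   | no w∉R  = contradiction T≤p+1+q (<⇒≱ (3-connected⇒rank-large M 3-conn A
                    (x∈p⇒0<∣p∣ u∈R) (x∈p⇒0<∣p∣ w∈∁[R∪X]) bound-A bound-∁A))
  where
  open ≤-Reasoning
  A = edgesIn G (R ∪ X)
  w∈∁[R∪X] : w ∈ ∁ (R ∪ X)
  w∈∁[R∪X] = x∉p⇒x∈∁p λ w∈R∪X → [ w∉R , x∈∁p⇒x∉p w∈∁X ]′ (x∈p∪q⁻ R X w∈R∪X)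
  R⊆∁X : R ⊆ ∁ X
  R⊆∁X z∈R = closed-star G (∁ X) (closed-self G (∁ X)) u∈∁X (reach z∈R)
  bound-A : r M A + ∣ ∁ (R ∪ X) ∣ ≤ r M ⊤
  bound-A = connected⇒r[edgesIn-W]+∣∁W∣≤r[⊤] M G wf conn (x∈p∪q⁺ (inj₁ u∈R))
  bound-∁A : r M (∁ A) + ∣ R ∣ ≤ r M ⊤
  bound-∁A = ≤-trans
    (+-mono-≤ (r-mono M (closed⇒∁edgesIn⊆ G R-closed R⊆∁X)) (p⊆q⇒∣p∣≤∣q∣ {p = R} λ z∈R → x∉p⇒x∈∁p (x∈p⇒x∉∁p z∈R)))
    (connected⇒r[edgesIn-W]+∣∁W∣≤r[⊤] M G wf conn (x∉p⇒x∈∁p w∉R))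
  T≤p+1+q : r M ⊤ ≤ ∣ R ∣ + 1 + ∣ ∁ (R ∪ X) ∣
  T≤p+1+q = begin
    r M ⊤                                   ≤⟨ connected⇒r[⊤]≤n M G wf conn u ⟩
    n                                       ≡⟨ sym (∣p∣+∣∁p∣≡n (R ∪ X)) ⟩
    ∣ R ∪ X ∣ + ∣ ∁ (R ∪ X) ∣               ≤⟨ +-monoˡ-≤ _ (∣p∪q∣≤∣p∣+∣q∣ R X) ⟩
    ∣ R ∣ + ∣ X ∣ + ∣ ∁ (R ∪ X) ∣           ≤⟨ +-monoˡ-≤ _ (+-monoʳ-≤ ∣ R ∣ (≤-pred ∣X∣<2)) ⟩
    ∣ R ∣ + 1 + ∣ ∁ (R ∪ X) ∣               ∎
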